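{- Suppose $\Sigma$ contains a function symbol of arity at least $2$, or contains at least two different unary function symbols. Then there exist natural numbers $N_1$ and $N_2$ such that for all natural numbers $N$ and $x$ with $x>N\cdot N_1+N_2$, the number of ground terms of weight $x$ is either $0$ or greater than $N$.
   Context: $\Sigma$ is a finite signature with at least one constant and $w:\Sigma\to\mathbb{N}$ a weight function: $w(a)>0$ for every constant $a$ and there is at most one unary function symbol of weight $0$. The weight of a ground term is $|c|=w(c)$, $|g(t_1,\dots,t_n)|=w(g)+|t_1|+\dots+|t_n|$. "Greater than $N$" includes the case of infinitely many terms. -}

module Defs where

open import Data.Nat using (ℕ; zero; suc; _+_; _*_; _<_; _≤_)
open import Data.Fin using (Fin)
open import Data.Vec using (Vec; []; _∷_)
open import Data.Product using (Σ; ∃; ∃-syntax; _×_; _,_)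
open import Data.Sum using (_⊎_)
open import Relation.Binary.PropositionalEquality using (_≡_; _≢_)
open import Relation.Nullary using (¬_)
open import Function.Definitions using (Injective)

record Signature : Set where
  field
    size  : ℕ
    arity : Fin size → ℕ

open Signature public

data Term (Σ' : Signature) : Set where
  node : (f : Fin (size Σ')) → Vec (Term Σ') (arity Σ' f) → Term Σ'

mutual
  weight : {Σ' : Signature} → (Fin (size Σ') → ℕ) → Term Σ' → ℕ
  weight w (node f ts) = w f + weights w ts

  weights : {Σ' : Signature} {n : ℕ} → (Fin (size Σ') → ℕ) → Vec (Term Σ') n → ℕ
  weights w [] = 0
  weights w (t ∷ ts) = weight w t + weights w ts

record Admissible (Σ' : Signature) (w : Fin (size Σ') → ℕ) : Set where
  field
    hasConstant   : ∃[ a ] arity Σ' a ≡ 0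
    constantsPos  : ∀ a → arity Σ' a ≡ 0 → 0 < w a
    unaryZeroUniq : ∀ f g → arity Σ' f ≡ 1 → arity Σ' g ≡ 1 →
                    w f ≡ 0 → w g ≡ 0 → f ≡ g

NonLinear : Signature → Set
NonLinear Σ' = (∃[ f ] 2 ≤ arity Σ' f)
             ⊎ (∃[ f ] ∃[ g ] (f ≢ g × arity Σ' f ≡ 1 × arity Σ' g ≡ 1))

NoTermOfWeight : (Σ' : Signature) → (Fin (size Σ') → ℕ) → ℕ → Set
NoTermOfWeight Σ' w x = ¬ (∃[ t ] weight {Σ'} w t ≡ x)

-- There are more than N ground terms of weight x (possibly infinitely many):
-- N+1 pairwise distinct terms of weight x.
MoreThanTermsOfWeight : (Σ' : Signature) → (Fin (size Σ') → ℕ) → ℕ → ℕ → Set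
MoreThanTermsOfWeight Σ' w N x =
  Σ (Fin (suc N) → Term Σ') λ ts →
    Injective _≡_ _≡_ ts × (∀ i → weight {Σ'} w (ts i) ≡ x)

{-# OPTIONS --safe #-}
module Submission where

-- Whether some term has weight x is decidable: after stripping weightless unary roots, a term
-- of weight x is f(t₁,…,tₖ) with every |tᵢ| < x, so well-founded recursion on x settles it.
--
-- Now let t be heavy. If some unary z has weight 0, the terms zⁱ(t) all weigh |t|. Otherwise
-- |t| is also the weight of a caterpillar: a stack of layers f(□,c₁,…,cₖ), with constants cᵢ,
-- on top of a constant. Every layer weighs at most maxArity · maxWeight, so the stack is long
-- and, by pigeonhole, more than N + maxArity · maxWeight of its layers share a head a. Weight
-- is additive over layers, so they may be reordered, and distinct terms of weight |t| arise
--  * if arity a ≥ 2, by letting the i-th a-layer take the rest of the stack as its second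
--    argument, so that the leftmost path has length i + 2;
--  * if a is unary (so w(a) > 0), by trading q a-layers for w(a) copies of a layer E of
--    weight q with head ≠ a, placed below i a-layers; E exists by the hypothesis on Σ.

open import Algebra.Properties.CommutativeSemigroup using (x∙yz≈y∙xz)
open import Data.Empty using (⊥-elim)
open import Data.Fin as Fin using (Fin; toℕ)
open import Data.Fin.Properties using (any?; toℕ-injective; toℕ≤pred[n])
open import Data.List as List using (List; []; _∷_; _++_; length; replicate; allFin)
open import Data.List.Membership.Propositional using (_∈_)
open import Data.List.Membership.Propositional.Properties using (∈-allFin)
open import Data.List.Properties
  using (∷-injectiveˡ; ∷-injectiveʳ; length-++; length-replicate; length-tabulate; map-++)
open import Data.List.Relation.Binary.Permutation.Propositional
  using (_↭_; ↭-refl; ↭-sym; ↭-trans; prep)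
open import Data.List.Relation.Binary.Permutation.Propositional.Properties
  using (↭-length; shift; shifts; ++⁺ˡ; map⁺)
open import Data.List.Relation.Unary.All as All using (All; []; _∷_)
open import Data.List.Relation.Unary.Any using (here; there)
open import Data.Nat
  using (ℕ; zero; suc; pred; _+_; _*_; _∸_; _⊔_; _<_; _≤_; _≟_; _≤?_; _<?_; z≤n; s≤s)
open import Data.Nat.Induction using (<-rec)
open import Data.Nat.ListAction using (sum)
open import Data.Nat.ListAction.Properties using (sum-++; sum-↭)
open import Data.Nat.Properties
open import Data.Nat.Tactic.RingSolver using (solve-∀)
open import Data.Product using (Σ; ∃; ∃₂; ∃-syntax; _×_; _,_; proj₁; proj₂)
open import Data.Sum using (_⊎_; inj₁; inj₂)
open import Data.Vec as Vec using (Vec; []; _∷_)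
open import Data.Vec.Relation.Unary.All as VecAll using ([]; _∷_)
import Data.Vec.Relation.Unary.All.Properties as VecAllₚ
open import Defs
open import Function using (_∘_; id)
open import Relation.Binary.PropositionalEquality
open import Relation.Nullary using (¬_; Dec; yes; no; _×-dec_; contradiction)
open import Relation.Nullary.Decidable using (map′)
open import Relation.Unary using (Decidable)

module _ {A K : Set} (class : A → K) where

  separate : ∀ {c cs} xs → All (λ x → class x ∈ c ∷ cs) xs →
             ∃₂ λ B C → All (λ x → class x ≡ c) B × All (λ x → class x ∈ cs) C × xs ↭ B ++ C
  separate []       []                 = [] , [] , [] , [] , ↭-refl
  separate (x ∷ xs) (here x≡c ∷ xs∈cs) with separate xs xs∈cs
  ... | B , C , B≡c , C∈cs , xs↭ = x ∷ B , C , x≡c ∷ B≡c , C∈cs , prep x xs↭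
  separate (x ∷ xs) (there x∈cs ∷ xs∈cs) with separate xs xs∈cs
  ... | B , C , B≡c , C∈cs , xs↭ =
    B , x ∷ C , B≡c , x∈cs ∷ C∈cs , ↭-trans (prep x xs↭) (↭-sym (shift x B C))

  pigeonhole : ∀ (cs : List K) m xs → All (λ x → class x ∈ cs) xs →
               length xs ≤ length cs * m ⊎
               ∃[ c ] ∃₂ λ B R → All (λ x → class x ≡ c) B × m < length B × xs ↭ B ++ R
  pigeonhole []       m []       []    = inj₁ z≤n
  pigeonhole (c ∷ cs) m xs xs∈cs with separate xs xs∈cs
  ... | B , C , B≡c , C∈cs , xs↭ with m <? length B
  ...   | yes crowded = inj₂ (c , B , C , B≡c , crowded , xs↭)
  ...   | no  sparse with pigeonhole cs m C C∈cs
  ...     | inj₂ (c′ , B′ , R , B′≡c′ , crowded , C↭) =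
    inj₂ (c′ , B′ , B ++ R , B′≡c′ , crowded , ↭-trans xs↭ (↭-trans (++⁺ˡ B C↭) (shifts B B′)))
  ...     | inj₁ C-short = inj₁ (begin
    length xs            ≡⟨ ↭-length xs↭ ⟩
    length (B ++ C)      ≡⟨ length-++ B ⟩
    length B + length C  ≤⟨ +-mono-≤ (≮⇒≥ sparse) C-short ⟩
    m + length cs * m    ∎)
    where open ≤-Reasoning

m<n+[m+o] : ∀ m n {o} → 0 < n + o → m < n + (m + o)
m<n+[m+o] m n {o} 0<n+o = subst (m <_) (x∙yz≈y∙xz +-commutativeSemigroup m n o) (m<m+n m 0<n+o)

replicate-++-∷-injective : ∀ {A : Set} {a e : A} {xs ys} i j → e ≢ a →
                           replicate i a ++ e ∷ xs ≡ replicate j a ++ e ∷ ys → i ≡ j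
replicate-++-∷-injective zero    zero    e≢a eq = refl
replicate-++-∷-injective zero    (suc j) e≢a eq = ⊥-elim (e≢a (∷-injectiveˡ eq))
replicate-++-∷-injective (suc i) zero    e≢a eq = ⊥-elim (e≢a (sym (∷-injectiveˡ eq)))
replicate-++-∷-injective (suc i) (suc j) e≢a eq =
  cong suc (replicate-++-∷-injective i j e≢a (∷-injectiveʳ eq))

replicate-++-pos : ∀ {A : Set} {k} {x : A} {xs} → 0 < k →
                   replicate k x ++ xs ≡ x ∷ replicate (pred k) x ++ xs
replicate-++-pos (s≤s _) = refl

upperBound : ∀ {n} (f : Fin n → ℕ) → ∃[ B ] (∀ i → f i ≤ B)
upperBound {zero}  f = 0 , λ ()
upperBound {suc n} f with upperBound (f ∘ Fin.suc)
... | B , f≤B = f Fin.zero ⊔ B , λ where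
  Fin.zero    → m≤m⊔n _ B
  (Fin.suc i) → ≤-trans (f≤B i) (m≤n⊔m _ B)

SumOf : (ℕ → Set) → ℕ → ℕ → Set
SumOf P k s = Σ (Vec ℕ k) λ v → VecAll.All P v × Vec.sum v ≡ s

sumOf? : ∀ {P} → Decidable P → ∀ k s → Dec (SumOf P k s)
sumOf? P? zero s = map′ (λ s≡0 → [] , [] , sym s≡0) (λ { ([] , [] , 0≡s) → sym 0≡s }) (s ≟ 0)
sumOf? {P} P? (suc k) s = map′ join split (anyUpTo? (λ z → P? z ×-dec sumOf? P? k (s ∸ z)) (suc s))
  where
  join : ∃[ z ] (z < suc s × P z × SumOf P k (s ∸ z)) → SumOf P (suc k) s
  join (z , s≤s z≤s , Pz , v , Pv , Σv≡) = z ∷ v , Pz ∷ Pv , trans (cong (z +_) Σv≡) (m+[n∸m]≡n z≤s)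
  split : SumOf P (suc k) s → ∃[ z ] (z < suc s × P z × SumOf P k (s ∸ z))
  split (z ∷ v , Pz ∷ Pv , refl) = z , s≤s (m≤m+n z _) , Pz , v , Pv , sym (m+n∸m≡n z _)

module WeightedTerms (Σ' : Signature) (w : Fin (size Σ') → ℕ) where

  Symbol : Set
  Symbol = Fin (size Σ')

  ∣_∣ : Term Σ' → ℕ
  ∣_∣ = weight w

  ∣_∣ᵛ : ∀ {n} → Vec (Term Σ') n → ℕ
  ∣_∣ᵛ = weights w

  -- Abstracting the arity allows pattern matching on the argument vector.
  node′ : ∀ f {n} → arity Σ' f ≡ n → Vec (Term Σ') n → Term Σ'
  node′ f refl ts = node f ts

  weight-node′ : ∀ f {n} (e : arity Σ' f ≡ n) ts → ∣ node′ f e ts ∣ ≡ w f + ∣ ts ∣ᵛ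
  weight-node′ f refl ts = refl

  weights≡sum : ∀ {n} (ts : Vec (Term Σ') n) → ∣ ts ∣ᵛ ≡ Vec.sum (Vec.map ∣_∣ ts)
  weights≡sum []       = refl
  weights≡sum (t ∷ ts) = cong (∣ t ∣ +_) (weights≡sum ts)

  Constant : Set
  Constant = Σ Symbol λ c → arity Σ' c ≡ 0

  leaf : Constant → Term Σ'
  leaf (c , e) = node′ c e []

  weight-leaf : ∀ c → ∣ leaf c ∣ ≡ w (proj₁ c)
  weight-leaf (c , e) = trans (weight-node′ c e []) (+-identityʳ (w c))

  HasTermOfWeight : ℕ → Set
  HasTermOfWeight x = ∃[ t ] ∣ t ∣ ≡ x

  realise : ∀ {k} {v : Vec ℕ k} → VecAll.All HasTermOfWeight v →
            Σ (Vec (Term Σ') k) λ ts → ∣ ts ∣ᵛ ≡ Vec.sum v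
  realise []                = [] , refl
  realise ((t , refl) ∷ ts) with realise ts
  ... | us , ∣us∣≡ = t ∷ us , cong (∣ t ∣ +_) ∣us∣≡

  module _ (constantsPos : ∀ a → arity Σ' a ≡ 0 → 0 < w a) where

    mutual
      weight-pos : ∀ t → 0 < ∣ t ∣
      weight-pos (node f ts) = weight-node′-pos f refl ts

      weight-node′-pos : ∀ f {n} (e : arity Σ' f ≡ n) ts → 0 < ∣ node′ f e ts ∣
      weight-node′-pos f e []       = subst (0 <_) (sym (weight-leaf (f , e))) (constantsPos f e)
      weight-node′-pos f e (t ∷ ts) = subst (0 <_) (sym (weight-node′ f e (t ∷ ts)))
        (<-≤-trans (weight-pos t) (≤-trans (m≤m+n ∣ t ∣ _) (m≤n+m _ (w f))))

    args-lighter : ∀ c {k} (ts : Vec (Term Σ') (suc k)) → 0 < c + k →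
                   VecAll.All (λ t → ∣ t ∣ < c + ∣ ts ∣ᵛ) ts
    args-lighter c (t ∷ [])      0<c+0 = m<n+[m+o] ∣ t ∣ c 0<c+0 ∷ []
    args-lighter c (t ∷ t′ ∷ ts) _     =
      m<n+[m+o] ∣ t ∣ c (≤-trans (weight-pos t′) (≤-trans (m≤m+n _ _) (m≤n+m _ c))) ∷
      VecAll.map (λ {s} → subst (∣ s ∣ <_) (+-assoc c ∣ t ∣ _))
        (args-lighter (c + ∣ t ∣) (t′ ∷ ts) (≤-trans (weight-pos t) (≤-trans (m≤n+m _ c) (m≤m+n _ _))))

    Lighter : ℕ → ℕ → Set
    Lighter y z = z < y × HasTermOfWeight z

    RootDecomposition : ℕ → Set
    RootDecomposition y = ∃[ f ] (w f ≤ y × SumOf (Lighter y) (arity Σ' f) (y ∸ w f))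

    assemble : ∀ {y} → RootDecomposition y → HasTermOfWeight y
    assemble {y} (f , wf≤y , v , lighter , Σv≡) with realise (VecAll.map proj₂ lighter)
    ... | ts , ∣ts∣≡ = node f ts , trans (cong (w f +_) (trans ∣ts∣≡ Σv≡)) (m+[n∸m]≡n wf≤y)

    decomposeLighter : ∀ f {n} (e : arity Σ' f ≡ n) ts →
                       VecAll.All (λ t → ∣ t ∣ < w f + ∣ ts ∣ᵛ) ts →
                       RootDecomposition ∣ node′ f e ts ∣
    decomposeLighter f refl ts lighter =
      f , m≤m+n (w f) _ , Vec.map ∣_∣ ts ,
      VecAllₚ.map⁺ (VecAll.map (λ {t} t< → t< , t , refl) lighter) ,
      sym (trans (m+n∸m≡n (w f) _) (weights≡sum ts))

    mutual
      decompose : ∀ t → RootDecomposition ∣ t ∣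
      decompose (node f ts) = decompose′ f refl ts

      decompose′ : ∀ f {n} (e : arity Σ' f ≡ n) ts → RootDecomposition ∣ node′ f e ts ∣
      decompose′ f e []              = decomposeLighter f e [] []
      decompose′ f e (t ∷ []) with w f ≟ 0
      ... | yes wf≡0 = subst RootDecomposition (sym ∣node′∣≡∣t∣) (decompose t)
        where
        ∣node′∣≡∣t∣ : ∣ node′ f e (t ∷ []) ∣ ≡ ∣ t ∣
        ∣node′∣≡∣t∣ = trans (weight-node′ f e (t ∷ []))
                        (trans (cong (_+ (∣ t ∣ + 0)) wf≡0) (+-identityʳ ∣ t ∣))
      ... | no  wf≢0 =
        decomposeLighter f e (t ∷ [])
          (args-lighter (w f) (t ∷ []) (≤-trans (n≢0⇒n>0 wf≢0) (m≤m+n (w f) 0)))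
      decompose′ f e ts@(_ ∷ _ ∷ _) =
        decomposeLighter f e ts (args-lighter (w f) ts (≤-trans (s≤s z≤n) (m≤n+m _ (w f))))

    hasTermOfWeight? : ∀ y → Dec (HasTermOfWeight y)
    hasTermOfWeight? = <-rec (Dec ∘ HasTermOfWeight) λ y rec →
      map′ assemble (λ (t , ∣t∣≡y) → subst RootDecomposition ∣t∣≡y (decompose t))
           (any? λ f → w f ≤? y ×-dec sumOf? (lighter? y rec) (arity Σ' f) (y ∸ w f))
      where
      lighter? : ∀ y → (∀ {z} → z < y → Dec (HasTermOfWeight z)) → Decidable (Lighter y)
      lighter? y rec z with z <? y
      ... | yes z<y = map′ (z<y ,_) proj₂ (rec z<y)
      ... | no  z≮y = no (z≮y ∘ proj₁)

  record Layer : Set where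
    constructor layer
    field
      head       : Symbol
      {width}    : ℕ
      arity-head : arity Σ' head ≡ suc width
      args       : Vec Constant width

  open Layer using (head)

  layerWeight : Layer → ℕ
  layerWeight (layer f _ cs) = w f + ∣ Vec.map leaf cs ∣ᵛ

  _▹_ : Layer → Term Σ' → Term Σ'
  layer f e cs ▹ t = node′ f e (t ∷ Vec.map leaf cs)

  stack : List Layer → Term Σ' → Term Σ'
  stack L t = List.foldr _▹_ t L

  stackWeight : List Layer → ℕ
  stackWeight L = sum (List.map layerWeight L)

  weight-▹ : ∀ l t → ∣ l ▹ t ∣ ≡ layerWeight l + ∣ t ∣
  weight-▹ (layer f e cs) t = begin
    ∣ node′ f e (t ∷ Vec.map leaf cs) ∣  ≡⟨ weight-node′ f e _ ⟩
    w f + (∣ t ∣ + ∣ Vec.map leaf cs ∣ᵛ)  ≡⟨ cong (w f +_) (+-comm ∣ t ∣ _) ⟩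
    w f + (∣ Vec.map leaf cs ∣ᵛ + ∣ t ∣)  ≡⟨ +-assoc (w f) _ ∣ t ∣ ⟨
    w f + ∣ Vec.map leaf cs ∣ᵛ + ∣ t ∣    ∎
    where open ≡-Reasoning

  weight-stack : ∀ L t → ∣ stack L t ∣ ≡ stackWeight L + ∣ t ∣
  weight-stack []      t = refl
  weight-stack (l ∷ L) t = begin
    ∣ l ▹ stack L t ∣                        ≡⟨ weight-▹ l (stack L t) ⟩
    layerWeight l + ∣ stack L t ∣            ≡⟨ cong (layerWeight l +_) (weight-stack L t) ⟩
    layerWeight l + (stackWeight L + ∣ t ∣)  ≡⟨ +-assoc (layerWeight l) _ ∣ t ∣ ⟨
    layerWeight l + stackWeight L + ∣ t ∣    ∎
    where open ≡-Reasoning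

  weight-stack-replicate : ∀ k l t → ∣ stack (replicate k l) t ∣ ≡ k * layerWeight l + ∣ t ∣
  weight-stack-replicate zero    l t = refl
  weight-stack-replicate (suc k) l t = begin
    ∣ l ▹ stack (replicate k l) t ∣              ≡⟨ weight-▹ l _ ⟩
    layerWeight l + ∣ stack (replicate k l) t ∣  ≡⟨ cong (layerWeight l +_) (weight-stack-replicate k l t) ⟩
    layerWeight l + (k * layerWeight l + ∣ t ∣)  ≡⟨ +-assoc (layerWeight l) _ ∣ t ∣ ⟨
    suc k * layerWeight l + ∣ t ∣                ∎
    where open ≡-Reasoning

  stackWeight-++ : ∀ L R → stackWeight (L ++ R) ≡ stackWeight L + stackWeight R
  stackWeight-++ L R = trans (cong sum (map-++ layerWeight L R)) (sum-++ (List.map layerWeight L) _)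

  stackWeight-↭ : ∀ {L R} → L ↭ R → stackWeight L ≡ stackWeight R
  stackWeight-↭ L↭R = sum-↭ (map⁺ layerWeight L↭R)

  stackWeight-uniform : ∀ {x L} → All (λ l → layerWeight l ≡ x) L → stackWeight L ≡ length L * x
  stackWeight-uniform []           = refl
  stackWeight-uniform (l≡x ∷ L≡x) = cong₂ _+_ l≡x (stackWeight-uniform L≡x)

  mutual
    spine : Term Σ' → List Symbol
    spine (node f ts) = f ∷ spineOfFirst ts

    spineOfFirst : ∀ {n} → Vec (Term Σ') n → List Symbol
    spineOfFirst []      = []
    spineOfFirst (t ∷ _) = spine t

  spine-node′ : ∀ f {n} (e : arity Σ' f ≡ n) ts → spine (node′ f e ts) ≡ f ∷ spineOfFirst ts
  spine-node′ f refl ts = refl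

  spine-▹ : ∀ l t → spine (l ▹ t) ≡ head l ∷ spine t
  spine-▹ (layer f e cs) t = spine-node′ f e _

  spine-stack-replicate : ∀ k l t → spine (stack (replicate k l) t) ≡ replicate k (head l) ++ spine t
  spine-stack-replicate zero    l t = refl
  spine-stack-replicate (suc k) l t = trans (spine-▹ l _) (cong (head l ∷_) (spine-stack-replicate k l t))

  mutual
    flatten : ∀ t → ∃₂ λ L b → ∣ t ∣ ≡ stackWeight L + ∣ leaf b ∣
    flatten (node f ts) = flattenNode f refl ts

    flattenNode : ∀ f {n} (e : arity Σ' f ≡ n) ts →
                  ∃₂ λ L b → ∣ node′ f e ts ∣ ≡ stackWeight L + ∣ leaf b ∣
    flattenNode f e []            = [] , (f , e) , refl
    flattenNode f e ts@(_ ∷ _) with flattenᵛ ts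
    ... | L , b ∷ bs , ∣ts∣≡ = layer f e bs ∷ L , b , (begin
      ∣ node′ f e ts ∣                          ≡⟨ weight-node′ f e ts ⟩
      w f + ∣ ts ∣ᵛ                             ≡⟨ cong (w f +_) ∣ts∣≡ ⟩
      w f + (stackWeight L + (∣ leaf b ∣ + c))  ≡⟨ regroup (w f) (stackWeight L) ∣ leaf b ∣ c ⟩
      w f + c + stackWeight L + ∣ leaf b ∣      ∎)
      where
      open ≡-Reasoning
      c = ∣ Vec.map leaf bs ∣ᵛ
      regroup : ∀ a l b c → a + (l + (b + c)) ≡ a + c + l + b
      regroup = solve-∀

    flattenᵛ : ∀ {n} (ts : Vec (Term Σ') n) →
               ∃₂ λ L (bs : Vec Constant n) → ∣ ts ∣ᵛ ≡ stackWeight L + ∣ Vec.map leaf bs ∣ᵛ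
    flattenᵛ []       = [] , [] , refl
    flattenᵛ (t ∷ ts) with flatten t | flattenᵛ ts
    ... | L , b , ∣t∣≡ | Ls , bs , ∣ts∣≡ = L ++ Ls , b ∷ bs , (begin
      ∣ t ∣ + ∣ ts ∣ᵛ                                      ≡⟨ cong₂ _+_ ∣t∣≡ ∣ts∣≡ ⟩
      (stackWeight L + ∣ leaf b ∣) + (stackWeight Ls + c)  ≡⟨ regroup (stackWeight L) ∣ leaf b ∣ _ c ⟩
      (stackWeight L + stackWeight Ls) + (∣ leaf b ∣ + c)  ≡⟨ cong (_+ _) (stackWeight-++ L Ls) ⟨
      stackWeight (L ++ Ls) + ∣ Vec.map leaf (b ∷ bs) ∣ᵛ   ∎)
      where
      open ≡-Reasoning
      c = ∣ Vec.map leaf bs ∣ᵛ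
      regroup : ∀ l b l′ c → (l + b) + (l′ + c) ≡ (l + l′) + (b + c)
      regroup = solve-∀

  maxWeight maxArity layerBound : ℕ
  maxWeight  = proj₁ (upperBound w)
  maxArity   = proj₁ (upperBound (arity Σ'))
  layerBound = maxArity * maxWeight

  w≤maxWeight : ∀ f → w f ≤ maxWeight
  w≤maxWeight = proj₂ (upperBound w)

  arity≤maxArity : ∀ f → arity Σ' f ≤ maxArity
  arity≤maxArity = proj₂ (upperBound (arity Σ'))

  weight-leaf≤ : ∀ c → ∣ leaf c ∣ ≤ maxWeight
  weight-leaf≤ c = ≤-trans (≤-reflexive (weight-leaf c)) (w≤maxWeight (proj₁ c))

  weight-leaves≤ : ∀ {k} (cs : Vec Constant k) → ∣ Vec.map leaf cs ∣ᵛ ≤ k * maxWeight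
  weight-leaves≤ []       = z≤n
  weight-leaves≤ (c ∷ cs) = +-mono-≤ (weight-leaf≤ c) (weight-leaves≤ cs)

  layerWeight≤ : ∀ l → layerWeight l ≤ layerBound
  layerWeight≤ (layer f {k} e cs) = begin
    w f + ∣ Vec.map leaf cs ∣ᵛ  ≤⟨ +-mono-≤ (w≤maxWeight f) (weight-leaves≤ cs) ⟩
    suc k * maxWeight           ≡⟨ cong (_* maxWeight) e ⟨
    arity Σ' f * maxWeight      ≤⟨ *-monoˡ-≤ maxWeight (arity≤maxArity f) ⟩
    maxArity * maxWeight        ∎
    where open ≤-Reasoning

  stackWeight≤ : ∀ L → stackWeight L ≤ length L * layerBound
  stackWeight≤ []      = z≤n
  stackWeight≤ (l ∷ L) = +-mono-≤ (layerWeight≤ l) (stackWeight≤ L)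

  crowdedHead : ∀ m L b → size Σ' * m * layerBound + maxWeight < stackWeight L + ∣ leaf b ∣ →
                ∃[ a ] ∃₂ λ A R → All (λ l → head l ≡ a) A × m < length A × L ↭ A ++ R
  crowdedHead m L b heavy with pigeonhole head (allFin (size Σ')) m L (All.universal (∈-allFin ∘ head) L)
  ... | inj₂ crowded = crowded
  ... | inj₁ short   = contradiction heavy (≤⇒≯ (begin
    stackWeight L + ∣ leaf b ∣            ≤⟨ +-mono-≤ (stackWeight≤ L) (weight-leaf≤ b) ⟩
    length L * layerBound + maxWeight     ≤⟨ +-monoˡ-≤ maxWeight (*-monoˡ-≤ layerBound short′) ⟩
    size Σ' * m * layerBound + maxWeight  ∎))
    where
    open ≤-Reasoning
    short′ : length L ≤ size Σ' * m
    short′ = subst (λ n → length L ≤ n * m) (length-tabulate {n = size Σ'} id) short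

  MoreThan : ℕ → ℕ → Set
  MoreThan = MoreThanTermsOfWeight Σ' w

  fromInjectiveFamily : ∀ {N x} (g : ℕ → Term Σ') →
                        (∀ {i j} → i ≤ N → j ≤ N → g i ≡ g j → i ≡ j) →
                        (∀ {i} → i ≤ N → ∣ g i ∣ ≡ x) → MoreThan N x
  fromInjectiveFamily g g-injective ∣g∣≡ =
    g ∘ toℕ ,
    (λ gi≡gj → toℕ-injective (g-injective (toℕ≤pred[n] _) (toℕ≤pred[n] _) gi≡gj)) ,
    (λ i → ∣g∣≡ (toℕ≤pred[n] i))

  spineLength-injective : ∀ {N} (g : ℕ → Term Σ') c →
                          (∀ {i} → i ≤ N → length (spine (g i)) ≡ i + c) →
                          ∀ {i j} → i ≤ N → j ≤ N → g i ≡ g j → i ≡ j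
  spineLength-injective g c len i≤N j≤N gi≡gj =
    +-cancelʳ-≡ c _ _ (trans (sym (len i≤N)) (trans (cong (length ∘ spine) gi≡gj) (len j≤N)))

  WeightlessUnary : Symbol → Set
  WeightlessUnary z = arity Σ' z ≡ 1 × w z ≡ 0

  weightlessUnaryFamily : ∀ {z} → WeightlessUnary z → ∀ N t → MoreThan N ∣ t ∣
  weightlessUnaryFamily {z} (unary , weightless) N t =
    fromInjectiveFamily g (spineLength-injective g (length (spine t)) spineLength) ∣g∣≡
    where
    u : Layer
    u = layer z unary []
    g : ℕ → Term Σ'
    g i = stack (replicate i u) t
    spineLength : ∀ {i} → i ≤ N → length (spine (g i)) ≡ i + length (spine t)
    spineLength {i} _ = begin
      length (spine (g i))                       ≡⟨ cong length (spine-stack-replicate i u t) ⟩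
      length (replicate i z ++ spine t)          ≡⟨ length-++ (replicate i z) ⟩
      length (replicate i z) + length (spine t)  ≡⟨ cong (_+ _) (length-replicate i) ⟩
      i + length (spine t)                       ∎
      where open ≡-Reasoning
    ∣g∣≡ : ∀ {i} → i ≤ N → ∣ g i ∣ ≡ ∣ t ∣
    ∣g∣≡ {i} _ = begin
      ∣ g i ∣                ≡⟨ weight-stack-replicate i u t ⟩
      i * (w z + 0) + ∣ t ∣  ≡⟨ cong (λ x → i * x + ∣ t ∣) (trans (+-identityʳ (w z)) weightless) ⟩
      i * 0 + ∣ t ∣          ≡⟨ cong (_+ ∣ t ∣) (*-zeroʳ i) ⟩
      ∣ t ∣                  ∎
      where open ≡-Reasoning

  flip : Layer → Term Σ' → Term Σ'
  flip (layer f e [])       t = layer f e [] ▹ t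
  flip (layer f e (c ∷ cs)) t = node′ f e (leaf c ∷ t ∷ Vec.map leaf cs)

  weight-flip : ∀ l t → ∣ flip l t ∣ ≡ layerWeight l + ∣ t ∣
  weight-flip (layer f e [])       t = weight-▹ (layer f e []) t
  weight-flip (layer f e (c ∷ cs)) t = trans (weight-node′ f e _) (regroup (w f) ∣ leaf c ∣ ∣ t ∣ _)
    where
    regroup : ∀ a b t r → a + (b + (t + r)) ≡ a + (b + r) + t
    regroup = solve-∀

  Branching : Layer → Set
  Branching l = 2 ≤ arity Σ' (head l)

  nonUnary-branching : ∀ l → arity Σ' (head l) ≢ 1 → Branching l
  nonUnary-branching (layer f {zero}  e _) non-unary = contradiction e non-unary
  nonUnary-branching (layer f {suc k} e _) _         = subst (2 ≤_) (sym e) (s≤s (s≤s z≤n))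

  spineLength-flip : ∀ l t → Branching l → length (spine (flip l t)) ≡ 2
  spineLength-flip (layer f e [])       t 2≤f = contradiction (subst (2 ≤_) e 2≤f) λ { (s≤s ()) }
  spineLength-flip (layer f e (c ∷ cs)) t _   =
    cong length (trans (spine-node′ f e _) (cong (f ∷_) (spine-node′ (proj₁ c) (proj₂ c) [])))

  flipAt : ℕ → List Layer → Term Σ' → Term Σ'
  flipAt i       []      t = t
  flipAt zero    (l ∷ L) t = flip l (stack L t)
  flipAt (suc i) (l ∷ L) t = l ▹ flipAt i L t

  weight-flipAt : ∀ i L t → ∣ flipAt i L t ∣ ≡ stackWeight L + ∣ t ∣
  weight-flipAt i       []      t = refl
  weight-flipAt zero    (l ∷ L) t = trans (weight-flip l _)
    (trans (cong (layerWeight l +_) (weight-stack L t)) (sym (+-assoc (layerWeight l) _ _)))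
  weight-flipAt (suc i) (l ∷ L) t = trans (weight-▹ l _)
    (trans (cong (layerWeight l +_) (weight-flipAt i L t)) (sym (+-assoc (layerWeight l) _ _)))

  spineLength-flipAt : ∀ {i L} t → All Branching L → i < length L → length (spine (flipAt i L t)) ≡ i + 2
  spineLength-flipAt {zero}  {l ∷ L} t (branching ∷ _) _ = spineLength-flip l (stack L t) branching
  spineLength-flipAt {suc i} {l ∷ L} t (_ ∷ branching) (s≤s i<) =
    trans (cong length (spine-▹ l _)) (cong suc (spineLength-flipAt t branching i<))

  flipFamily : ∀ {N L} → All Branching L → N < length L → ∀ t → MoreThan N (stackWeight L + ∣ t ∣)
  flipFamily {N} {L} branching long t = fromInjectiveFamily g
    (spineLength-injective g 2 λ i≤N → spineLength-flipAt t branching (≤-<-trans i≤N long))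
    (λ {i} _ → weight-flipAt i L t)
    where
    g : ℕ → Term Σ'
    g i = flipAt i L t

  exchangeFamily : ∀ u E → head E ≢ head u → 0 < layerWeight u →
                   ∀ {N n} → N + layerWeight E ≤ n → ∀ t → MoreThan N (n * layerWeight u + ∣ t ∣)
  exchangeFamily u E E≢u u>0 {N} {n} N+q≤n t = fromInjectiveFamily g g-injective ∣g∣≡
    where
    m q : ℕ
    m = layerWeight u
    q = layerWeight E
    rest : ℕ → Term Σ'
    rest i = stack (replicate (n ∸ (i + q)) u) t
    g : ℕ → Term Σ'
    g i = stack (replicate i u) (stack (replicate m E) (rest i))

    spine-g : ∀ i → spine (g i) ≡ replicate i (head u) ++ head E ∷ replicate (pred m) (head E) ++ spine (rest i)
    spine-g i = begin
      spine (g i)                                                     ≡⟨ spine-stack-replicate i u _ ⟩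
      replicate i (head u) ++ spine (stack (replicate m E) (rest i))  ≡⟨ cong (replicate i (head u) ++_)
                                                                           (spine-stack-replicate m E (rest i)) ⟩
      replicate i (head u) ++ replicate m (head E) ++ spine (rest i)  ≡⟨ cong (replicate i (head u) ++_)
                                                                           (replicate-++-pos u>0) ⟩
      replicate i (head u) ++ head E ∷ replicate (pred m) (head E) ++ spine (rest i) ∎
      where open ≡-Reasoning

    g-injective : ∀ {i j} → i ≤ N → j ≤ N → g i ≡ g j → i ≡ j
    g-injective {i} {j} _ _ gi≡gj =
      replicate-++-∷-injective i j E≢u (trans (sym (spine-g i)) (trans (cong spine gi≡gj) (spine-g j)))

    ∣g∣≡ : ∀ {i} → i ≤ N → ∣ g i ∣ ≡ n * m + ∣ t ∣
    ∣g∣≡ {i} i≤N = begin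
      ∣ g i ∣                                        ≡⟨ weight-stack-replicate i u _ ⟩
      i * m + ∣ stack (replicate m E) (rest i) ∣     ≡⟨ cong (i * m +_) (weight-stack-replicate m E (rest i)) ⟩
      i * m + (m * q + ∣ rest i ∣)                   ≡⟨ cong (λ x → i * m + (m * q + x))
                                                          (weight-stack-replicate (n ∸ (i + q)) u t) ⟩
      i * m + (m * q + ((n ∸ (i + q)) * m + ∣ t ∣))  ≡⟨ regroup i m q (n ∸ (i + q)) ∣ t ∣ ⟩
      ((i + q) + (n ∸ (i + q))) * m + ∣ t ∣          ≡⟨ cong (λ x → x * m + ∣ t ∣) (m+[n∸m]≡n i+q≤n) ⟩
      n * m + ∣ t ∣                                  ∎
      where
      open ≡-Reasoning
      i+q≤n : i + q ≤ n
      i+q≤n = ≤-trans (+-monoˡ-≤ q i≤N) N+q≤n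
      regroup : ∀ i m q d t → i * m + (m * q + (d * m + t)) ≡ ((i + q) + d) * m + t
      regroup = solve-∀

  layerWeight-unary : ∀ l → arity Σ' (head l) ≡ 1 → layerWeight l ≡ w (head l)
  layerWeight-unary (layer f {zero}  e []) _     = +-identityʳ (w f)
  layerWeight-unary (layer f {suc k} e cs) unary = contradiction (suc-injective (trans (sym e) unary)) 1+n≢0

  otherLayer : Constant → NonLinear Σ' → ∀ a → arity Σ' a ≡ 1 → ∃[ E ] head E ≢ a
  otherLayer c (inj₁ (f , 2≤f)) a unary with m≤n⇒∃[o]m+o≡n 2≤f
  ... | o , 2+o≡f = E , f≢a
    where
    E : Layer
    E = layer f (sym 2+o≡f) (Vec.replicate (suc o) c)
    f≢a : f ≢ a
    f≢a f≡a = 1+n≢0 (suc-injective (trans 2+o≡f (trans (cong (arity Σ') f≡a) unary)))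
  otherLayer c (inj₂ (g , h , g≢h , unary-g , unary-h)) a unary with g Fin.≟ a
  ... | yes refl = layer h unary-h [] , g≢h ∘ sym
  ... | no  g≢a  = layer g unary-g [] , g≢a

  module _ (c : Constant) (nonLinear : NonLinear Σ') where

    uniformStackFamily : ¬ ∃ WeightlessUnary →
                         ∀ {N a A} → All (λ l → head l ≡ a) A → N + layerBound < length A →
                         ∀ t → MoreThan N (stackWeight A + ∣ t ∣)
    uniformStackFamily noWeightless {N} {a} {A} heads long t with arity Σ' a ≟ 1
    ... | no non-unary = flipFamily (All.map (λ {l} → branching {l}) heads) (≤-trans (s≤s (m≤m+n N _)) long) t
      where
      branching : ∀ {l} → head l ≡ a → Branching l
      branching {l} refl = nonUnary-branching l non-unary
    ... | yes unary with otherLayer c nonLinear a unary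
    ...   | E , E≢a = subst (λ x → MoreThan N (x + ∣ t ∣)) (sym ∣A∣)
                        (exchangeFamily u E E≢a u>0 (≤-trans (+-monoʳ-≤ N (layerWeight≤ E)) (<⇒≤ long)) t)
      where
      u : Layer
      u = layer a unary []
      u>0 : 0 < layerWeight u
      u>0 = ≤-trans (n≢0⇒n>0 λ weightless → noWeightless (a , unary , weightless)) (m≤m+n (w a) 0)
      weight-a : ∀ {l} → head l ≡ a → layerWeight l ≡ layerWeight u
      weight-a {l} refl = trans (layerWeight-unary l unary) (sym (+-identityʳ (w a)))
      ∣A∣ : stackWeight A ≡ length A * layerWeight u
      ∣A∣ = stackWeight-uniform (All.map (λ {l} → weight-a {l}) heads)

    manyTermsOfLargeWeight : ∀ N t → size Σ' * (N + layerBound) * layerBound + maxWeight < ∣ t ∣ →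
                             MoreThan N ∣ t ∣
    manyTermsOfLargeWeight N t heavy with any? (λ z → arity Σ' z ≟ 1 ×-dec w z ≟ 0)
    ... | yes (z , weightlessUnary) = weightlessUnaryFamily weightlessUnary N t
    ... | no  noWeightless with flatten t
    ... | L , b , ∣t∣≡ with crowdedHead (N + layerBound) L b (subst (_ <_) ∣t∣≡ heavy)
    ... | a , A , R , heads , long , L↭ =
      subst (MoreThan N) (sym ∣t∣≡A+R) (uniformStackFamily noWeightless heads long (stack R (leaf b)))
      where
      open ≡-Reasoning
      ∣t∣≡A+R : ∣ t ∣ ≡ stackWeight A + ∣ stack R (leaf b) ∣
      ∣t∣≡A+R = begin
        ∣ t ∣                                         ≡⟨ ∣t∣≡ ⟩
        stackWeight L + ∣ leaf b ∣                    ≡⟨ cong (_+ ∣ leaf b ∣) (stackWeight-↭ L↭) ⟩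
        stackWeight (A ++ R) + ∣ leaf b ∣             ≡⟨ cong (_+ ∣ leaf b ∣) (stackWeight-++ A R) ⟩
        stackWeight A + stackWeight R + ∣ leaf b ∣    ≡⟨ +-assoc (stackWeight A) _ _ ⟩
        stackWeight A + (stackWeight R + ∣ leaf b ∣)  ≡⟨ cong (stackWeight A +_) (weight-stack R (leaf b)) ⟨
        stackWeight A + ∣ stack R (leaf b) ∣          ∎

lemma15 : (Σ' : Signature) (w : Fin (size Σ') → ℕ) → Admissible Σ' w →
          NonLinear Σ' →
          ∃[ N₁ ] ∃[ N₂ ] (∀ N x → N * N₁ + N₂ < x →
            NoTermOfWeight Σ' w x ⊎ MoreThanTermsOfWeight Σ' w N x)
lemma15 Σ' w admissible nonLinear = size Σ' * Q , size Σ' * Q * Q + maxWeight , dichotomy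
  where
  open WeightedTerms Σ' w
  open Admissible admissible using (hasConstant; constantsPos)

  Q : ℕ
  Q = layerBound

  threshold : ∀ N → N * (size Σ' * Q) + (size Σ' * Q * Q + maxWeight) ≡ size Σ' * (N + Q) * Q + maxWeight
  threshold N = expand N (size Σ') Q maxWeight
    where
    expand : ∀ N S Q B → N * (S * Q) + (S * Q * Q + B) ≡ S * (N + Q) * Q + B
    expand = solve-∀

  dichotomy : ∀ N x → N * (size Σ' * Q) + (size Σ' * Q * Q + maxWeight) < x →
              NoTermOfWeight Σ' w x ⊎ MoreThanTermsOfWeight Σ' w N x
  dichotomy N x heavy with hasTermOfWeight? constantsPos x
  ... | no  none       = inj₁ none
  ... | yes (t , refl) =
    inj₂ (manyTermsOfLargeWeight hasConstant nonLinear N t (subst (_< ∣ t ∣) (threshold N) heavy))
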